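{- If $\alpha,\beta$ are signatures with $\alpha\leq\beta$, then there is a p-morphism $\mathbb{T}_\beta\to\mathbb{T}_\alpha$.
   Context: A signature is either $\epsilon$ or $\alpha=n_1^{m_1}\cdots n_k^{m_k}$ with integers $n_1>\cdots>n_k\geq1$, $m_i\geq1$; its length is $|\alpha|=\sum m_i$ ($|\epsilon|=0$) and $\alpha(1)\geq\cdots\geq\alpha(|\alpha|)$ lists each $n_i$ exactly $m_i$ times. $\alpha\leq\beta$ means $|\alpha|\leq|\beta|$ and $\alpha(j)\leq\beta(j)$ for all $j\leq|\alpha|$. The starlike tree $\mathbb{T}_\alpha$ is the poset consisting of a root together with, for each $i$, $m_i$ chains of $n_i$ elements, pairwise disjoint and incomparable and all above the root; $\mathbb{T}_\epsilon$ is a single point. A p-morphism $f\colon F\to G$ between posets is a map with $f({\uparrow}x)={\uparrow}f(x)$ for all $x\in F$, where ${\uparrow}x=\{y:y\geq x\}$. -}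

module Defs where

open import Data.Nat using (ℕ; zero; suc; _≤_; _<_; _>_)
open import Data.Nat.Properties using ()
open import Data.Fin using (Fin; toℕ)
open import Data.List using (List; []; _∷_; length; lookup; map; replicate; concatMap)
open import Data.Nat.ListAction using (sum)
open import Data.Product using (_×_; _,_; proj₁; proj₂; ∃; Σ)
open import Data.Unit using (⊤)
open import Relation.Binary.PropositionalEquality using (_≡_)

-- Signatures
-- A signature is ε (empty list) or n₁^m₁ ⋯ n_k^m_k, represented by the
-- list of pairs (n₁ , m₁) ∷ ⋯ ∷ (n_k , m_k) with n₁ > ⋯ > n_k ≥ 1 and
-- every mᵢ ≥ 1.

ValidPairs : List (ℕ × ℕ) → Set
ValidPairs [] = ⊤
ValidPairs ((n , m) ∷ []) = (1 ≤ n) × (1 ≤ m)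
ValidPairs ((n , m) ∷ ((n' , m') ∷ ps)) =
  (n > n') × (1 ≤ m) × ValidPairs ((n' , m') ∷ ps)

record Signature : Set where
  constructor sig
  field
    pairs : List (ℕ × ℕ)
    valid : ValidPairs pairs
open Signature public

∣_∣ : Signature → ℕ
∣ α ∣ = sum (map proj₂ (pairs α))

seqOf : Signature → List ℕ
seqOf α = concatMap (λ p → replicate (proj₂ p) (proj₁ p)) (pairs α)

-- α at (0-based) position j; 0 outside the range (never used there)
at : List ℕ → ℕ → ℕ
at [] j = 0
at (x ∷ xs) zero = x
at (x ∷ xs) (suc j) = at xs j

-- α(j+1), i.e. 0-based indexing of the paper's α(1),…,α(|α|)
_⟨_⟩ : Signature → ℕ → ℕ
α ⟨ j ⟩ = at (seqOf α) j

_≼_ : Signature → Signature → Set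
α ≼ β = (∣ α ∣ ≤ ∣ β ∣) × (∀ (j : ℕ) → j < ∣ α ∣ → α ⟨ j ⟩ ≤ β ⟨ j ⟩)

-- Starlike trees T_α
-- Elements: the root, or node i c k = the k-th element (k = 0 is the
-- lowest) of the c-th copy (c < mᵢ) of the chain of length nᵢ.

module _ (ps : List (ℕ × ℕ)) where
  data TNode : Set where
    root : TNode
    node : (i : Fin (length ps)) → Fin (proj₂ (lookup ps i)) → Fin (proj₁ (lookup ps i)) → TNode

  data _⊑_ : TNode → TNode → Set where
    root⊑ : ∀ x → root ⊑ x
    chain⊑ : ∀ i c k k' → toℕ k ≤ toℕ k' → node i c k ⊑ node i c k'

T : Signature → Set
T α = TNode (pairs α)


-- p-morphisms: f(↑x) = ↑f(x), unfolded as the two inclusions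
-- (⊆: monotone; ⊇: every z ≥ f x is f y for some y ≥ x)
IsPMorphism : (α β : Signature) → (T α → T β) → Set
IsPMorphism α β f =
  (∀ x y → _⊑_ (pairs α) x y → _⊑_ (pairs β) (f x) (f y)) ×
  (∀ x z → _⊑_ (pairs β) (f x) z → ∃ λ y → _⊑_ (pairs α) x y × f y ≡ z)

{-# OPTIONS --safe #-}
module Submission where

open import Defs
open import Data.Product using (Σ; _×_; _,_; proj₁; proj₂; ∃)
open import Data.Nat using (ℕ; zero; suc; _≤_; _<_; _+_; _⊓_; z≤n; s≤s; s≤s⁻¹; _<?_; _≤?_)
open import Data.Nat.Properties
open import Data.Nat.ListAction using (sum)
open import Data.Fin using (Fin; toℕ; fromℕ<; inject≤; _↑ˡ_; _↑ʳ_; splitAt)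
  renaming (zero to fzero; suc to fsuc)
open import Data.Fin.Properties
  using (toℕ<n; toℕ-injective; toℕ-fromℕ<; toℕ-inject≤; toℕ-↑ˡ; toℕ-↑ʳ;
         splitAt-↑ˡ; splitAt-↑ʳ; splitAt⁻¹-↑ˡ; splitAt⁻¹-↑ʳ)
open import Data.List using (List; []; _∷_; _++_; length; lookup; map; replicate; concatMap)
open import Data.Sum using (inj₁; inj₂; [_,_]′)
open import Data.Empty using (⊥-elim)
open import Function using (_∘_)
open import Relation.Nullary using (yes; no; ¬_; contradiction)
open import Relation.Binary.PropositionalEquality
  using (_≡_; refl; sym; trans; cong; subst; subst₂; module ≡-Reasoning)

-- Number the chains of T_α by the positions j < |α|, so that the j-th chain
-- has α(j) elements.  Send the root to the root and the j-th chain of T_β to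
-- the j-th chain of T_α if j < |α|, to a fixed chain otherwise.  A chain with
-- b elements is mapped to one with top t (so t + 1 elements) by k ↦ min(k, t)
-- if t < b and constantly to the top otherwise; both maps are p-morphisms of
-- chains, and they glue to a p-morphism of trees as soon as every node of T_α
-- is hit.  Since α ≤ β, the j-th chain of T_α is the image of the j-th chain
-- of T_β, which is at least as long, so every node is indeed hit.

squash : ℕ → ℕ → ℕ → ℕ
squash t b k with t <? b
... | yes _ = k ⊓ t
... | no  _ = t

squash-≤ : ∀ t b k → squash t b k ≤ t
squash-≤ t b k with t <? b
... | yes _ = m⊓n≤n k t
... | no  _ = ≤-refl

squash-mono : ∀ t b {k k'} → k ≤ k' → squash t b k ≤ squash t b k'
squash-mono t b k≤k' with t <? b
... | yes _ = ⊓-monoˡ-≤ t k≤k'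
... | no  _ = ≤-refl

squash-id : ∀ {t b k} → t < b → k ≤ t → squash t b k ≡ k
squash-id {t} {b} t<b k≤t with t <? b
... | yes _  = m≤n⇒m⊓n≡m k≤t
... | no t≮b = contradiction t<b t≮b

squash-back : ∀ t b {k u} → k < b → squash t b k ≤ u → u ≤ t →
              ∃ λ k' → k ≤ k' × k' < b × squash t b k' ≡ u
squash-back t b {k} {u} k<b le u≤t with t <? b
... | no  _ = k , ≤-refl , k<b , ≤-antisym le u≤t
... | yes t<b with k ≤? u
...   | yes k≤u = u , k≤u , ≤-<-trans u≤t t<b , m≤n⇒m⊓n≡m u≤t
...   | no  k≰u = k , ≤-refl , k<b , ≤-antisym le (⊓-glb (<⇒≤ (≰⇒> k≰u)) u≤t)

IsChainPMorphism : ∀ {a b} → (Fin b → Fin a) → Set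
IsChainPMorphism f =
  (∀ {k k'} → toℕ k ≤ toℕ k' → toℕ (f k) ≤ toℕ (f k')) ×
  (∀ k u → toℕ (f k) ≤ toℕ u → ∃ λ k' → toℕ k ≤ toℕ k' × f k' ≡ u)

level : ∀ {a b} → 0 < a → Fin b → Fin a
level {suc t} {b} _ k = fromℕ< (s≤s (squash-≤ t b (toℕ k)))

toℕ-level : ∀ {t b} (0<a : 0 < suc t) (k : Fin b) → toℕ (level 0<a k) ≡ squash t b (toℕ k)
toℕ-level _ _ = toℕ-fromℕ< _

level-isChainPMorphism : ∀ {a b} (0<a : 0 < a) → IsChainPMorphism (level {a} {b} 0<a)
level-isChainPMorphism {suc t} {b} 0<a = mono , back
  where
  mono : ∀ {k k'} → toℕ k ≤ toℕ k' → toℕ (level 0<a k) ≤ toℕ (level 0<a k')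
  mono {k} {k'} k≤k' =
    subst₂ _≤_ (sym (toℕ-level 0<a k)) (sym (toℕ-level 0<a k')) (squash-mono t b k≤k')

  back : ∀ k u → toℕ (level 0<a k) ≤ toℕ u → ∃ λ k' → toℕ k ≤ toℕ k' × level 0<a k' ≡ u
  back k u le with squash-back t b (toℕ<n k) (subst (_≤ toℕ u) (toℕ-level 0<a k) le)
                                  (s≤s⁻¹ (toℕ<n u))
  ... | k' , k≤k' , k'<b , squash≡u =
    fromℕ< k'<b , subst (toℕ k ≤_) (sym (toℕ-fromℕ< k'<b)) k≤k' ,
    toℕ-injective (trans (toℕ-level 0<a (fromℕ< k'<b))
                         (trans (cong (squash t b) (toℕ-fromℕ< k'<b)) squash≡u))

level-id : ∀ {a b} (0<a : 0 < a) (k : Fin b) → a ≤ b → toℕ k < a → toℕ (level 0<a k) ≡ toℕ k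
level-id {suc t} 0<a k a≤b k<a = trans (toℕ-level 0<a k) (squash-id a≤b (s≤s⁻¹ k<a))

record Chain (ps : List (ℕ × ℕ)) : Set where
  constructor chain
  field
    number : Fin (length ps)
    copy   : Fin (proj₂ (lookup ps number))

chainLength : ∀ {ps} → Chain ps → ℕ
chainLength {ps} (chain i _) = proj₁ (lookup ps i)

chainLength-pos : ∀ {ps} → ValidPairs ps → (ch : Chain ps) → 0 < chainLength ch
chainLength-pos {_ ∷ []}     (1≤n , _)     (chain fzero _)    = 1≤n
chainLength-pos {_ ∷ _ ∷ _}  (n>n' , _)    (chain fzero _)    = ≤-trans (s≤s z≤n) n>n'
chainLength-pos {_ ∷ p ∷ ps} (_ , _ , vps) (chain (fsuc i) c) = chainLength-pos {p ∷ ps} vps (chain i c)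

nodeAt : ∀ {ps} (ch : Chain ps) → Fin (chainLength ch) → TNode ps
nodeAt (chain i c) k = node i c k

nodeAt-cong : ∀ {ps} {ch ch' : Chain ps} {k : Fin (chainLength ch)} {k' : Fin (chainLength ch')} →
              ch ≡ ch' → toℕ k ≡ toℕ k' → nodeAt ch k ≡ nodeAt ch' k'
nodeAt-cong refl k≡k' = cong (nodeAt _) (toℕ-injective k≡k')

⊑-refl : ∀ {ps} (x : TNode ps) → _⊑_ ps x x
⊑-refl root         = root⊑ root
⊑-refl (node i c k) = chain⊑ i c k k ≤-refl

chainCount : List (ℕ × ℕ) → ℕ
chainCount ps = sum (map proj₂ ps)

chainLengths : List (ℕ × ℕ) → List ℕ
chainLengths = concatMap (λ p → replicate (proj₂ p) (proj₁ p))

here : ∀ {n m ps} → Fin m → Chain ((n , m) ∷ ps)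
here c = chain fzero c

there : ∀ {p ps} → Chain ps → Chain (p ∷ ps)
there (chain i c) = chain (fsuc i) c

index : ∀ ps → Chain ps → Fin (chainCount ps)
index ((_ , m) ∷ ps) (chain fzero c)    = c ↑ˡ chainCount ps
index ((_ , m) ∷ ps) (chain (fsuc i) c) = m ↑ʳ index ps (chain i c)

chainAt : ∀ ps → Fin (chainCount ps) → Chain ps
chainAt ((_ , m) ∷ ps) j = [ here , there ∘ chainAt ps ]′ (splitAt m j)

chainAt-index : ∀ ps ch → chainAt ps (index ps ch) ≡ ch
chainAt-index ((_ , m) ∷ ps) (chain fzero c)
  rewrite splitAt-↑ˡ m c (chainCount ps) = refl
chainAt-index ((_ , m) ∷ ps) (chain (fsuc i) c)
  rewrite splitAt-↑ʳ m (chainCount ps) (index ps (chain i c)) =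
    cong there (chainAt-index ps (chain i c))

index-chainAt : ∀ ps j → index ps (chainAt ps j) ≡ j
index-chainAt ((_ , m) ∷ ps) j with splitAt m j in eq
... | inj₁ _  = splitAt⁻¹-↑ˡ eq
... | inj₂ j' = trans (cong (m ↑ʳ_) (index-chainAt ps j')) (splitAt⁻¹-↑ʳ eq)

at-replicate-++ : ∀ m n r {j} → j < m → at (replicate m n ++ r) j ≡ n
at-replicate-++ (suc m) n r {zero}  _         = refl
at-replicate-++ (suc m) n r {suc j} (s≤s j<m) = at-replicate-++ m n r j<m

at-replicate-++-skip : ∀ m n r e → at (replicate m n ++ r) (m + e) ≡ at r e
at-replicate-++-skip zero    n r e = refl
at-replicate-++-skip (suc m) n r e = at-replicate-++-skip m n r e

at-chainLengths-index : ∀ ps ch → at (chainLengths ps) (toℕ (index ps ch)) ≡ chainLength ch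
at-chainLengths-index ((n , m) ∷ ps) (chain fzero c)
  rewrite toℕ-↑ˡ c (chainCount ps) = at-replicate-++ m n (chainLengths ps) (toℕ<n c)
at-chainLengths-index ((n , m) ∷ ps) (chain (fsuc i) c)
  rewrite toℕ-↑ʳ m (index ps (chain i c)) =
    trans (at-replicate-++-skip m n (chainLengths ps) _) (at-chainLengths-index ps (chain i c))

module _ {α β : Signature}
         (g : Chain (pairs β) → Chain (pairs α))
         (h : ∀ ch → Fin (chainLength ch) → Fin (chainLength (g ch))) where

  liftChains : T β → T α
  liftChains root         = root
  liftChains (node i c k) = nodeAt (g (chain i c)) (h (chain i c) k)

  liftChains-isPMorphism : (∀ ch → IsChainPMorphism (h ch)) →
                           (∀ ch k → ∃ λ y → liftChains y ≡ nodeAt ch k) →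
                           IsPMorphism β α liftChains
  liftChains-isPMorphism h-pmorphism onto = mono , back
    where
    mono : ∀ x y → _⊑_ (pairs β) x y → _⊑_ (pairs α) (liftChains x) (liftChains y)
    mono root y _ = root⊑ _
    mono (node i c k) (node .i .c k') (chain⊑ .i .c .k .k' k≤k') =
      chain⊑ _ _ _ _ (proj₁ (h-pmorphism (chain i c)) k≤k')

    backAlong : ∀ ch k u → toℕ (h ch k) ≤ toℕ u →
                ∃ λ y → _⊑_ (pairs β) (nodeAt ch k) y × liftChains y ≡ nodeAt (g ch) u
    backAlong ch k u le with proj₂ (h-pmorphism ch) k u le
    ... | k' , k≤k' , k'↦u = nodeAt ch k' , chain⊑ _ _ k k' k≤k' , cong (nodeAt (g ch)) k'↦u

    back : ∀ x z → _⊑_ (pairs α) (liftChains x) z → ∃ λ y → _⊑_ (pairs β) x y × liftChains y ≡ z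
    back root root _ = root , root⊑ root , refl
    back root (node i c k) _ with onto (chain i c) k
    ... | y , y↦z = y , root⊑ y , y↦z
    back (node i c k) (node _ _ u) (chain⊑ _ _ _ _ le) = backAlong (chain i c) k u le

toRoot-isPMorphism : ∀ {α β} → ¬ Chain (pairs α) → IsPMorphism β α (λ _ → root)
toRoot-isPMorphism {α} {β} noChain = (λ _ _ _ → root⊑ root) , back
  where
  back : ∀ x z → _⊑_ (pairs α) root z → ∃ λ y → _⊑_ (pairs β) x y × root ≡ z
  back x root         _ = x , ⊑-refl x , refl
  back x (node i c k) _ = ⊥-elim (noChain (chain i c))

module Collapse (α β : Signature) (α≼β : α ≼ β) (default : Fin ∣ α ∣) where

  shrink : Fin ∣ β ∣ → Fin ∣ α ∣
  shrink j with toℕ j <? ∣ α ∣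
  ... | yes j<∣α∣ = fromℕ< j<∣α∣
  ... | no  _     = default

  widen : Fin ∣ α ∣ → Fin ∣ β ∣
  widen j = inject≤ j (proj₁ α≼β)

  shrink-widen : ∀ j → shrink (widen j) ≡ j
  shrink-widen j with toℕ (widen j) <? ∣ α ∣
  ... | yes j<∣α∣ = toℕ-injective (trans (toℕ-fromℕ< j<∣α∣) (toℕ-inject≤ j _))
  ... | no  j≮∣α∣ = contradiction (subst (_< ∣ α ∣) (sym (toℕ-inject≤ j _)) (toℕ<n j)) j≮∣α∣

  chainMap : Chain (pairs β) → Chain (pairs α)
  chainMap = chainAt (pairs α) ∘ shrink ∘ index (pairs β)

  section : Chain (pairs α) → Chain (pairs β)
  section = chainAt (pairs β) ∘ widen ∘ index (pairs α)

  chainMap-section : ∀ ch → chainMap (section ch) ≡ ch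
  chainMap-section ch = begin
    chainAt (pairs α) (shrink (index (pairs β) (section ch)))
      ≡⟨ cong (chainAt (pairs α) ∘ shrink) (index-chainAt (pairs β) _) ⟩
    chainAt (pairs α) (shrink (widen (index (pairs α) ch)))
      ≡⟨ cong (chainAt (pairs α)) (shrink-widen _) ⟩
    chainAt (pairs α) (index (pairs α) ch)
      ≡⟨ chainAt-index (pairs α) ch ⟩
    ch ∎
    where open ≡-Reasoning

  chainLength-section : ∀ ch → chainLength ch ≤ chainLength (section ch)
  chainLength-section ch = begin
    chainLength ch
      ≡⟨ at-chainLengths-index (pairs α) ch ⟨
    α ⟨ toℕ j ⟩
      ≤⟨ proj₂ α≼β (toℕ j) (toℕ<n j) ⟩
    β ⟨ toℕ j ⟩
      ≡⟨ cong (at (seqOf β)) (toℕ-inject≤ j _) ⟨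
    β ⟨ toℕ (widen j) ⟩
      ≡⟨ cong (at (seqOf β) ∘ toℕ) (index-chainAt (pairs β) (widen j)) ⟨
    β ⟨ toℕ (index (pairs β) (section ch)) ⟩
      ≡⟨ at-chainLengths-index (pairs β) (section ch) ⟩
    chainLength (section ch) ∎
    where
    open ≤-Reasoning
    j = index (pairs α) ch

  chainMap-pos : ∀ ch → 0 < chainLength (chainMap ch)
  chainMap-pos ch = chainLength-pos (valid α) (chainMap ch)

  collapse : T β → T α
  collapse = liftChains {α} {β} chainMap (level ∘ chainMap-pos)

  collapse-onto : ∀ ch k → ∃ λ y → collapse y ≡ nodeAt ch k
  collapse-onto ch k =
    nodeAt (section ch) k₀ ,
    nodeAt-cong (chainMap-section ch)
      (trans (level-id _ k₀ a≤b k₀<a) (toℕ-fromℕ< k<b))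
    where
    a≡ : chainLength (chainMap (section ch)) ≡ chainLength ch
    a≡ = cong chainLength (chainMap-section ch)
    a≤b : chainLength (chainMap (section ch)) ≤ chainLength (section ch)
    a≤b = subst (_≤ chainLength (section ch)) (sym a≡) (chainLength-section ch)
    k<b : toℕ k < chainLength (section ch)
    k<b = <-≤-trans (toℕ<n k) (chainLength-section ch)
    k₀ : Fin (chainLength (section ch))
    k₀ = fromℕ< k<b
    k₀<a : toℕ k₀ < chainLength (chainMap (section ch))
    k₀<a = subst₂ _<_ (sym (toℕ-fromℕ< k<b)) (sym a≡) (toℕ<n k)

  collapse-isPMorphism : IsPMorphism β α collapse
  collapse-isPMorphism =
    liftChains-isPMorphism chainMap _ (level-isChainPMorphism ∘ chainMap-pos) collapse-onto

proposition6p1 : (α β : Signature) → α ≼ β → Σ (T β → T α) (IsPMorphism β α)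
proposition6p1 α β α≼β with 0 <? ∣ α ∣
... | yes 0<∣α∣ = Collapse.collapse α β α≼β default , Collapse.collapse-isPMorphism α β α≼β default
  where default = fromℕ< 0<∣α∣
... | no  ∣α∣≯0 = (λ _ → root) , toRoot-isPMorphism {α} {β} noChain
  where
  noChain : ¬ Chain (pairs α)
  noChain ch = ∣α∣≯0 (≤-<-trans z≤n (toℕ<n (index (pairs α) ch)))
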